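{- Let $A$ be a type and let $\tau$ be a stack history over $A$ that is continuous, complete and stacklike. Let $l_1,l_2$ be finite lists over $A$ such that $\mathsf{Pushed}(\tau,l_1)$ and $\mathsf{Popped}(\tau,l_2)$ hold and $|l_1|=|l_2|$. Then $l_1$ and $l_2$ are equal as multisets (i.e. $l_2$ is a permutation of $l_1$).
   Context: A stack history over $A$ is a finite partial map $\tau$ from natural numbers (timestamps) to pairs $(s,s')$ of finite lists over $A$; we write $t\mapsto(s,s')\in\tau$ to mean $t\in\mathrm{dom}(\tau)$ and $\tau(t)=(s,s')$. $e::m$ denotes the list with head $e$ and tail $m$; $|l|$ is the length of $l$. $\tau$ is continuous if whenever $\tau(t)=(s_1,s_2)$ and $\tau(t+1)=(s_3,s_4)$ then $s_2=s_3$. $\tau$ is complete if there is a list $l_0$ with $\tau(0)=(l_0,l_0)$ and every $t<|\mathrm{dom}(\tau)|$ lies in $\mathrm{dom}(\tau)$. $\tau$ is stacklike if for every $t\in\mathrm{dom}(\tau)$ with $t>0$ there exist a list $m$ and an element $e$ with $\tau(t)=(m,e::m)$ or $\tau(t)=(e::m,m)$. $\mathsf{Pushed}(\tau,l)$ means: $l$ is equal as a multiset to the multiset sum, over all $t\in\mathrm{dom}(\tau)$, of: $\{e\}$ if $\tau(t)=(m,e::m)$ for some $m,e$; and additionally, if $t=0$ and $\tau(0)=(m,m)$, the multiset of all elements of $m$ (with multiplicity). $\mathsf{Popped}(\tau,l)$ means: $l$ is equal as a multiset to the multiset containing one copy of $e$ for each $t\in\mathrm{dom}(\tau)$ with $\tau(t)=(e::m,m)$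 for some list $m$. -}

module Defs where

open import Data.Nat using (ℕ; zero; suc; _<_)
open import Data.List using (List; []; _∷_; [_]; map; length; concat)
open import Data.List.Membership.Propositional using (_∈_)
open import Data.List.Relation.Unary.Unique.Propositional using (Unique)
open import Data.List.Relation.Binary.Pointwise using (Pointwise)
open import Data.List.Relation.Binary.Permutation.Propositional using (_↭_)
open import Data.Product using (Σ; ∃; ∃-syntax; _×_; _,_; proj₁)
open import Data.Sum using (_⊎_)
open import Relation.Binary.PropositionalEquality using (_≡_)
open import Relation.Nullary using (¬_)

Entry : Set → Set
Entry A = ℕ × (List A × List A)

-- A finite partial map ℕ ⇀ (List A × List A), represented as an
-- association list whose keys (timestamps) are pairwise distinct.
record StackHistory (A : Set) : Set where
  constructor mkHistory
  field
    entries    : List (Entry A)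
    uniqueKeys : Unique (map proj₁ entries)
open StackHistory public

_↦_∈_ : {A : Set} → ℕ → List A × List A → StackHistory A → Set
t ↦ v ∈ τ = (t , v) ∈ entries τ

domSize : {A : Set} → StackHistory A → ℕ
domSize τ = length (entries τ)

Continuous : {A : Set} → StackHistory A → Set
Continuous {A} τ = ∀ (t : ℕ) (s₁ s₂ s₃ s₄ : List A) →
  t ↦ (s₁ , s₂) ∈ τ → suc t ↦ (s₃ , s₄) ∈ τ → s₂ ≡ s₃

Complete : {A : Set} → StackHistory A → Set
Complete {A} τ =
  (∃[ l₀ ] (0 ↦ (l₀ , l₀) ∈ τ)) ×
  (∀ (t : ℕ) → t < domSize τ → ∃[ v ] (t ↦ v ∈ τ))

Stacklike : {A : Set} → StackHistory A → Set
Stacklike {A} τ = ∀ (t : ℕ) (v : List A × List A) → t ↦ v ∈ τ → 0 < t →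
  ∃[ m ] ∃[ e ] (v ≡ (m , e ∷ m) ⊎ v ≡ (e ∷ m , m))

data PushContrib {A : Set} : Entry A → List A → Set where
  push  : ∀ {t m e} → PushContrib (t , (m , e ∷ m)) [ e ]
  init  : ∀ {m} → PushContrib (0 , (m , m)) m
  other : ∀ {t s s'} →
          ¬ (∃[ e ] (s' ≡ e ∷ s)) → ¬ (t ≡ 0 × s ≡ s') →
          PushContrib (t , (s , s')) []

data PopContrib {A : Set} : Entry A → List A → Set where
  pop   : ∀ {t m e} → PopContrib (t , (e ∷ m , m)) [ e ]
  other : ∀ {t s s'} → ¬ (∃[ e ] (s ≡ e ∷ s')) →
          PopContrib (t , (s , s')) []

Pushed : {A : Set} → StackHistory A → List A → Set
Pushed {A} τ l = ∃[ cs ] (Pointwise PushContrib (entries τ) cs × l ↭ concat cs)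

Popped : {A : Set} → StackHistory A → List A → Set
Popped {A} τ l = ∃[ cs ] (Pointwise PopContrib (entries τ) cs × l ↭ concat cs)

module Submission where

-- Every entry of a stacklike history is balanced as a multiset:
-- pushed + stack before ↭ popped + stack after.  Summing over all entries,
-- the stacks before and after telescope: by completeness and uniqueness of
-- timestamps the entries are those at times 0, …, n − 1, and by continuity the
-- stack before time t + 1 is the stack after time t.  What remains is
-- pushed ↭ popped + final stack, so equal lengths force the final stack to be empty.

open import Defs
open import Algebra using (CommutativeMonoid)
open import Data.List using (List; []; _∷_; _++_; length; map; concat; downFrom)
open import Data.List.Membership.Propositional using (_∈_)
open import Data.List.Membership.Propositional.Properties using (∈-∃++; ∈-++⁻; ∈-++⁺ˡ; ∈-++⁺ʳ; ∈-map⁺)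
open import Data.List.Properties using (++-identityʳ; ++-assoc)
open import Data.List.Relation.Binary.Permutation.Propositional
  using (_↭_; ↭-refl; ↭-prep; ↭-reflexive; ↭-sym; ↭-trans; ↭-isEquivalence; ↭-setoid; ↭⇒↭ₛ′; module PermutationReasoning)
open import Data.List.Relation.Binary.Permutation.Propositional.Properties
  using (++⁺ˡ; ++⁺; ++-comm; drop-∷; shift; ↭-length; map⁺; ++-isCommutativeMonoid; ++-commutativeMonoid)
import Data.List.Relation.Binary.Permutation.Setoid.Properties as Permutationₛ
open import Data.List.Relation.Binary.Pointwise using (Pointwise; []; _∷_)
open import Data.List.Relation.Binary.Subset.Propositional using (_⊆_)
import Data.List.Relation.Unary.All as All
open import Data.List.Relation.Unary.AllPairs using (_∷_)
open import Data.List.Relation.Unary.Any using (here; there)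
open import Data.List.Relation.Unary.Unique.Propositional using (Unique)
open import Data.List.Relation.Unary.Unique.Propositional.Properties using (map⁻; downFrom⁺)
open import Data.Nat using (zero; suc; _≤_; _<_; s≤s; z≤n)
open import Data.Nat.Properties using (<⇒≤; ≤-refl; suc-injective)
open import Data.Product using (∃-syntax; _×_; _,_; proj₁; proj₂)
open import Data.Sum using (inj₁; inj₂)
open import Relation.Binary.PropositionalEquality using (_≡_; _≢_; refl; sym; trans; cong; subst; module ≡-Reasoning)
open import Relation.Nullary using (contradiction)

module _ {A : Set} where

  ++-cancelˡ : ∀ xs {ys zs : List A} → xs ++ ys ↭ xs ++ zs → ys ↭ zs
  ++-cancelˡ []       p = p
  ++-cancelˡ (x ∷ xs) p = ++-cancelˡ xs (drop-∷ p)

  ++-cancelʳ : ∀ zs {xs ys : List A} → xs ++ zs ↭ ys ++ zs → xs ↭ ys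
  ++-cancelʳ zs {xs} {ys} p = ++-cancelˡ zs (↭-trans (++-comm zs xs) (↭-trans p (++-comm ys zs)))

  length[xs++ys]≡length[xs]⇒ys≡[] : ∀ xs {ys : List A} → length (xs ++ ys) ≡ length xs → ys ≡ []
  length[xs++ys]≡length[xs]⇒ys≡[] []       {[]}    _  = refl
  length[xs++ys]≡length[xs]⇒ys≡[] (_ ∷ xs)         eq = length[xs++ys]≡length[xs]⇒ys≡[] xs (suc-injective eq)

  ∈-drop-mid : ∀ {x y : A} xs ys → y ∈ xs ++ x ∷ ys → y ≢ x → y ∈ xs ++ ys
  ∈-drop-mid xs ys y∈ y≢x with ∈-++⁻ xs y∈
  ... | inj₁ y∈xs         = ∈-++⁺ˡ y∈xs
  ... | inj₂ (here y≡x)   = contradiction y≡x y≢x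
  ... | inj₂ (there y∈ys) = ∈-++⁺ʳ xs y∈ys

  Unique∧⊆∧length≡⇒↭ : ∀ {xs ys : List A} → Unique xs → xs ⊆ ys → length xs ≡ length ys → xs ↭ ys
  Unique∧⊆∧length≡⇒↭ {[]}     {[]}    _ _ _ = ↭-refl
  Unique∧⊆∧length≡⇒↭ {x ∷ xs} (x∉xs ∷ xs!) xs⊆ys |xs|≡|ys|
    with p , q , refl ← ∈-∃++ (xs⊆ys (here refl)) =
    ↭-trans (↭-prep x (Unique∧⊆∧length≡⇒↭ xs! xs⊆p++q |xs|≡|p++q|)) (↭-sym (shift x p q))
    where
    xs⊆p++q : xs ⊆ p ++ q
    xs⊆p++q y∈xs = ∈-drop-mid p q (xs⊆ys (there y∈xs)) λ y≡x → All.lookup x∉xs y∈xs (sym y≡x)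
    |xs|≡|p++q| : length xs ≡ length (p ++ q)
    |xs|≡|p++q| = suc-injective (trans |xs|≡|ys| (↭-length (shift x p q)))

  Unique[map-proj₁]⇒functional : ∀ {B : Set} {xs : List (A × B)} {k v w} →
    Unique (map proj₁ xs) → (k , v) ∈ xs → (k , w) ∈ xs → v ≡ w
  Unique[map-proj₁]⇒functional (_ ∷ _)    (here refl) (here refl) = refl
  Unique[map-proj₁]⇒functional (k∉ks ∷ _) (here refl) (there w∈)  = contradiction refl (All.lookup k∉ks (∈-map⁺ proj₁ w∈))
  Unique[map-proj₁]⇒functional (k∉ks ∷ _) (there v∈)  (here refl) = contradiction refl (All.lookup k∉ks (∈-map⁺ proj₁ v∈))
  Unique[map-proj₁]⇒functional (_ ∷ ks!)  (there v∈)  (there w∈)  = Unique[map-proj₁]⇒functional ks! v∈ w∈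

module _ {A B : Set} where

  concat-map⁺ : ∀ (f : A → List B) {xs ys} → xs ↭ ys → concat (map f xs) ↭ concat (map f ys)
  concat-map⁺ f p = Permutationₛ.foldr-commMonoid ↭-setoid ++-isCommutativeMonoid
    (↭⇒↭ₛ′ ↭-isEquivalence (map⁺ f p))

  open import Algebra.Properties.CommutativeSemigroup
    (CommutativeMonoid.commutativeSemigroup (++-commutativeMonoid {A = B})) using (interchange)

  concat-balance : ∀ {P Q : A → List B → Set} (f g : A → List B) {xs cs ds} →
    (∀ {x c d} → x ∈ xs → P x c → Q x d → c ++ f x ↭ d ++ g x) →
    Pointwise P xs cs → Pointwise Q xs ds →
    concat cs ++ concat (map f xs) ↭ concat ds ++ concat (map g xs)
  concat-balance f g balance [] [] = ↭-refl
  concat-balance f g {x ∷ xs} {c ∷ cs} {d ∷ ds} balance (p ∷ ps) (q ∷ qs) = begin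
    (c ++ concat cs) ++ (f x ++ concat (map f xs))  ↭⟨ interchange c (concat cs) (f x) _ ⟩
    (c ++ f x) ++ (concat cs ++ concat (map f xs))  ↭⟨ ++⁺ (balance (here refl) p q)
                                                           (concat-balance f g (λ x∈ → balance (there x∈)) ps qs) ⟩
    (d ++ g x) ++ (concat ds ++ concat (map g xs))  ↭⟨ interchange d (g x) (concat ds) _ ⟩
    (d ++ concat ds) ++ (g x ++ concat (map g xs))  ∎
    where open PermutationReasoning

module _ {A : Set} where

  initial-balance : ∀ {l c d : List A} → PushContrib (0 , l , l) c → PopContrib (0 , l , l) d → c ++ [] ↭ d ++ l
  initial-balance {l} init            (other _) = ↭-reflexive (++-identityʳ l)
  initial-balance     (other _ ¬init) _         = contradiction (refl , refl) ¬init

  push-balance : ∀ {t e} {m c d : List A} →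
    PushContrib (suc t , m , e ∷ m) c → PopContrib (suc t , m , e ∷ m) d → c ++ m ↭ d ++ e ∷ m
  push-balance push            (other _) = ↭-refl
  push-balance (other ¬push _) _         = contradiction (_ , refl) ¬push

  pop-balance : ∀ {t e} {m c d : List A} →
    PushContrib (suc t , e ∷ m , m) c → PopContrib (suc t , e ∷ m , m) d → c ++ e ∷ m ↭ d ++ m
  pop-balance (other _ _) pop           = ↭-refl
  pop-balance _           (other ¬pop) = contradiction (_ , refl) ¬pop

  -- The initial stack is counted as pushed at time 0, so the stack "before" time 0 is empty.
  stackBefore : Entry A → List A
  stackBefore (zero  , _)     = []
  stackBefore (suc _ , s , _) = s

  stackAfter : Entry A → List A
  stackAfter (_ , _ , s′) = s′

  lastStack : List (Entry A) → List A
  lastStack []      = []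
  lastStack (x ∷ _) = stackAfter x

module History {A : Set} (τ : StackHistory A) (at : ∀ t → t < domSize τ → ∃[ v ] (t ↦ v ∈ τ)) where

  trace : ∀ n → n ≤ domSize τ → List (Entry A)
  trace zero    _      = []
  trace (suc t) t<|τ| = (t , proj₁ (at t t<|τ|)) ∷ trace t (<⇒≤ t<|τ|)

  trace-⊆ : ∀ n n≤|τ| → trace n n≤|τ| ⊆ entries τ
  trace-⊆ (suc t) t<|τ| (here refl) = proj₂ (at t t<|τ|)
  trace-⊆ (suc t) t<|τ| (there x∈)  = trace-⊆ t (<⇒≤ t<|τ|) x∈

  map-proj₁-trace : ∀ n n≤|τ| → map proj₁ (trace n n≤|τ|) ≡ downFrom n
  map-proj₁-trace zero    _      = refl
  map-proj₁-trace (suc t) t<|τ| = cong (t ∷_) (map-proj₁-trace t (<⇒≤ t<|τ|))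

  length-trace : ∀ n n≤|τ| → length (trace n n≤|τ|) ≡ n
  length-trace zero    _      = refl
  length-trace (suc t) t<|τ| = cong suc (length-trace t (<⇒≤ t<|τ|))

  entries↭trace : entries τ ↭ trace (domSize τ) ≤-refl
  entries↭trace = ↭-sym (Unique∧⊆∧length≡⇒↭
    (map⁻ (subst Unique (sym (map-proj₁-trace _ ≤-refl)) (downFrom⁺ (domSize τ))))
    (trace-⊆ _ ≤-refl)
    (length-trace _ ≤-refl))

  trace-telescope : Continuous τ → ∀ n n≤|τ| →
    concat (map stackAfter (trace n n≤|τ|))
      ↭ lastStack (trace n n≤|τ|) ++ concat (map stackBefore (trace n n≤|τ|))
  trace-telescope cont zero          _ = ↭-refl
  trace-telescope cont (suc zero)    _ = ↭-refl
  trace-telescope cont (suc (suc t)) t+1<|τ|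
    with at (suc t) t+1<|τ| | at t (<⇒≤ t+1<|τ|) | trace-telescope cont (suc t) (<⇒≤ t+1<|τ|)
  ... | (s , s′) , now | (r , r′) , previous | telescope
    rewrite cont t r r′ s s′ previous now = ++⁺ˡ s′ telescope

  finalStack : List A
  finalStack = lastStack (trace (domSize τ) ≤-refl)

  telescope : Continuous τ →
    concat (map stackAfter (entries τ)) ↭ finalStack ++ concat (map stackBefore (entries τ))
  telescope cont = begin
    concat (map stackAfter (entries τ))                          ↭⟨ concat-map⁺ stackAfter entries↭trace ⟩
    concat (map stackAfter (trace _ ≤-refl))                     ↭⟨ trace-telescope cont _ ≤-refl ⟩
    finalStack ++ concat (map stackBefore (trace _ ≤-refl))      ↭⟨ ++⁺ˡ finalStack (concat-map⁺ stackBefore (↭-sym entries↭trace)) ⟩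
    finalStack ++ concat (map stackBefore (entries τ))           ∎
    where open PermutationReasoning

  entry-balance : ∀ {l₀} → Stacklike τ → 0 ↦ (l₀ , l₀) ∈ τ →
    ∀ {x c d} → x ∈ entries τ → PushContrib x c → PopContrib x d →
    c ++ stackBefore x ↭ d ++ stackAfter x
  entry-balance stack initial {zero , _} x∈ p q
    with refl ← Unique[map-proj₁]⇒functional (uniqueKeys τ) x∈ initial = initial-balance p q
  entry-balance stack initial {suc t , v} x∈ p q with stack (suc t) v x∈ (s≤s z≤n)
  ... | _ , _ , inj₁ refl = push-balance p q
  ... | _ , _ , inj₂ refl = pop-balance p q

  pushed↭popped++finalStack : ∀ {l₀ cs ds} → Continuous τ → Stacklike τ → 0 ↦ (l₀ , l₀) ∈ τ →
    Pointwise PushContrib (entries τ) cs → Pointwise PopContrib (entries τ) ds →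
    concat cs ↭ concat ds ++ finalStack
  pushed↭popped++finalStack {cs = cs} {ds} cont stack initial pushes pops = ++-cancelʳ befores (begin
    concat cs ++ befores                   ↭⟨ concat-balance stackBefore stackAfter (entry-balance stack initial) pushes pops ⟩
    concat ds ++ afters                    ↭⟨ ++⁺ˡ (concat ds) (telescope cont) ⟩
    concat ds ++ (finalStack ++ befores)   ≡⟨ ++-assoc (concat ds) finalStack befores ⟨
    (concat ds ++ finalStack) ++ befores   ∎)
    where
    open PermutationReasoning
    befores afters : List A
    befores = concat (map stackBefore (entries τ))
    afters  = concat (map stackAfter (entries τ))

lemma2 : {A : Set} (τ : StackHistory A) →
    Continuous τ → Complete τ → Stacklike τ →
    (l₁ l₂ : List A) → Pushed τ l₁ → Popped τ l₂ →
    length l₁ ≡ length l₂ → l₁ ↭ l₂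
lemma2 τ cont ((_ , initial) , at) stack l₁ l₂ (cs , pushes , l₁↭) (ds , pops , l₂↭) |l₁|≡|l₂| =
  let open PermutationReasoning in begin
    l₁                       ↭⟨ l₁↭ ⟩
    concat cs                ↭⟨ balance ⟩
    concat ds ++ finalStack  ≡⟨ cong (concat ds ++_) finalStack≡[] ⟩
    concat ds ++ []          ≡⟨ ++-identityʳ (concat ds) ⟩
    concat ds                ↭⟨ l₂↭ ⟨
    l₂                       ∎
  where
  open History τ at
  balance : concat cs ↭ concat ds ++ finalStack
  balance = pushed↭popped++finalStack cont stack initial pushes pops
  finalStack≡[] : finalStack ≡ []
  finalStack≡[] = length[xs++ys]≡length[xs]⇒ys≡[] (concat ds) (begin
    length (concat ds ++ finalStack)  ≡⟨ ↭-length balance ⟨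
    length (concat cs)                ≡⟨ ↭-length l₁↭ ⟨
    length l₁                         ≡⟨ |l₁|≡|l₂| ⟩
    length l₂                         ≡⟨ ↭-length l₂↭ ⟩
    length (concat ds)                ∎)
    where open ≡-Reasoning
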